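{- Let $m_1,m_2$ be integers with $1 \leq m_1 \leq m_2$ and let $G = K_{1,m_1}+K_{1,m_2}$. If $m_1+m_2 \geq 16$, then $G$ is not equitably 2-choosable.
   Context: A list assignment $L$ for a graph $G$ assigns to each vertex $v$ a set $L(v)$ of colors; it is a $k$-assignment if $|L(v)|=k$ for all $v$. The palette of $L$ is $\bigcup_{v} L(v)$. A proper $L$-coloring is a proper coloring $f$ with $f(v)\in L(v)$ for all $v$. If $L$ is a $k$-assignment, an equitable $L$-coloring of $G$ is a proper $L$-coloring in which each color of the palette appears on at most $\lceil |V(G)|/k \rceil$ vertices. $G$ is equitably $k$-choosable if an equitable $L$-coloring exists for every $k$-assignment $L$ for $G$. -}

module Defs where

open import Data.Nat using (ℕ; zero; suc; _+_; _∸_; _≤_; NonZero)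
open import Data.Nat.DivMod using (_/_)
open import Data.Fin using (Fin; zero; suc; splitAt)
open import Data.Fin.Base using ()
open import Data.List using (List; length; filter; allFin)
open import Data.List.Membership.Propositional using (_∈_)
open import Data.List.Relation.Unary.Unique.Propositional using (Unique)
open import Data.Product using (Σ; ∃; _×_; _,_)
open import Data.Sum using (_⊎_; inj₁; inj₂)
open import Data.Unit using (⊤)
open import Data.Empty using (⊥)
open import Relation.Binary.PropositionalEquality using (_≡_; _≢_)
open import Relation.Nullary using (¬_)
open import Data.Nat.Properties using (_≟_)

record Graph (n : ℕ) : Set₁ where
  field
    Adj : Fin n → Fin n → Set

open Graph public

Color : Set
Color = ℕ

ListAssignment : ℕ → Set
ListAssignment n = Fin n → List Color

IsKAssignment : ∀ {n} → ℕ → ListAssignment n → Set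
IsKAssignment {n} k L = ∀ (v : Fin n) → Unique (L v) × length (L v) ≡ k

InPalette : ∀ {n} → ListAssignment n → Color → Set
InPalette {n} L c = ∃ λ (v : Fin n) → c ∈ L v

IsProperLColoring : ∀ {n} → Graph n → ListAssignment n → (Fin n → Color) → Set
IsProperLColoring {n} G L f =
  (∀ (v : Fin n) → f v ∈ L v) × (∀ (u v : Fin n) → Adj G u v → f u ≢ f v)

colorCount : ∀ {n} → (Fin n → Color) → Color → ℕ
colorCount {n} f c = length (filter (λ v → f v ≟ c) (allFin n))

ceilDiv : (n k : ℕ) → .{{NonZero k}} → ℕ
ceilDiv n k = (n + k ∸ 1) / k

IsEquitableLColoring : ∀ {n} → Graph n → (k : ℕ) → .{{NonZero k}} →
                       ListAssignment n → (Fin n → Color) → Set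
IsEquitableLColoring {n} G k L f =
  IsProperLColoring G L f ×
  (∀ (c : Color) → InPalette L c → colorCount f c ≤ ceilDiv n k)

EquitablyChoosable : ∀ {n} → Graph n → (k : ℕ) → .{{NonZero k}} → Set
EquitablyChoosable {n} G k =
  ∀ (L : ListAssignment n) → IsKAssignment k L →
  ∃ λ (f : Fin n → Color) → IsEquitableLColoring G k L f

StarAdj : ∀ {m} → Fin (suc m) → Fin (suc m) → Set
StarAdj zero    zero    = ⊥
StarAdj zero    (suc _) = ⊤
StarAdj (suc _) zero    = ⊤
StarAdj (suc _) (suc _) = ⊥

Star : (m : ℕ) → Graph (suc m)
Star m = record { Adj = StarAdj }

SumAdj : ∀ {a b} → Graph a → Graph b → Fin a ⊎ Fin b → Fin a ⊎ Fin b → Set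
SumAdj G H (inj₁ u) (inj₁ v) = Adj G u v
SumAdj G H (inj₁ _) (inj₂ _) = ⊥
SumAdj G H (inj₂ _) (inj₁ _) = ⊥
SumAdj G H (inj₂ u) (inj₂ v) = Adj H u v

DisjointUnion : ∀ {a b} → Graph a → Graph b → Graph (a + b)
DisjointUnion {a} {b} G H =
  record { Adj = λ u v → SumAdj G H (splitAt a u) (splitAt a v) }

TwoStars : (m₁ m₂ : ℕ) → Graph (suc m₁ + suc m₂)
TwoStars m₁ m₂ = DisjointUnion (Star m₁) (Star m₂)

module Submission where

-- Write n = (m₁ + 1) + (m₂ + 1) for the number of vertices of
-- K_{1,m₁} + K_{1,m₂}.  We exhibit a 2-assignment L with no equitable
-- L-colouring: the centre of the first star gets {1,2}, every vertex of the
-- second star gets {3,4}, and the leaves of the first star run cyclically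
-- through the four lists {1,3}, {1,4}, {2,3}, {2,4}.  In a proper L-colouring
-- let the centres receive a ∈ {1,2} and b ∈ {3,4}, and let c be the other
-- colour of {3,4}.  All m₂ leaves of the second star are forced to c, and so
-- are the C leaves of the first star carrying the list {a,c}, where
-- m₁ ≤ 4C + 3.  Thus c is used at least C + m₂ times, and the hypotheses
-- m₁ ≤ m₂ and 16 ≤ m₁ + m₂ make C + m₂ exceed ⌈n/2⌉.

open import Defs
open import Data.Nat using (ℕ; zero; suc; _+_; _*_; _≤_; _<_; z≤n; s≤s)
open import Data.Nat.Properties
  using (_≟_; ≤-trans; <-≤-trans; <⇒≱; +-assoc; +-mono-≤;
         +-monoˡ-≤; +-monoʳ-≤; +-cancelˡ-≤; m≤m+n; m≤n+m; module ≤-Reasoning)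
open import Data.Nat.DivMod using (m<n*o⇒m/o<n)
open import Data.Nat.Tactic.RingSolver using (solve-∀)
open import Data.Fin using (Fin; zero; suc; splitAt; toℕ; _↑ˡ_; _↑ʳ_)
import Data.Fin.Properties as Fin
open import Data.List using (List; []; _∷_; length; filter; tabulate)
open import Data.List.Membership.Propositional using (_∈_)
open import Data.List.Relation.Unary.Any using (here; there)
open import Data.List.Relation.Unary.All using ([]; _∷_)
open import Data.List.Relation.Unary.AllPairs using ([]; _∷_)
open import Data.List.Relation.Unary.Unique.Propositional using (Unique)
open import Data.List.Relation.Binary.Subset.Propositional using (_⊆_)
open import Data.List.Relation.Binary.Subset.Propositional.Properties
  using (⊆-refl; ⊆-trans; ⊆-reflexive; ⊆-reflexive-↭)
open import Data.List.Relation.Binary.Permutation.Propositional using (↭-swap; ↭-refl)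
open import Data.Product using (∃₂; _×_; _,_; proj₁)
open import Data.Sum using (_⊎_; inj₁; inj₂)
open import Data.Unit using (tt)
open import Data.Bool using (true; false; if_then_else_)
open import Data.Empty using (⊥-elim)
open import Function using (_∘_)
open import Relation.Nullary using (¬_; Dec; does; yes; no; contradiction)
open import Relation.Unary using (Pred; Decidable)
open import Relation.Binary.PropositionalEquality
  using (_≡_; _≢_; refl; sym; trans; cong; subst; subst₂)

indicator : ∀ {p} {P : Set p} → Dec P → ℕ
indicator P? = if does P? then 1 else 0

count : ∀ {n p} {P : Pred (Fin n) p} → Decidable P → ℕ
count {zero}  P? = 0
count {suc n} P? = indicator (P? zero) + count (P? ∘ suc)

length-filter-tabulate : ∀ {a p n} {A : Set a} {P : Pred A p} (P? : Decidable P)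
                         (g : Fin n → A) →
                         length (filter P? (tabulate g)) ≡ count (P? ∘ g)
length-filter-tabulate {n = zero}  P? g = refl
length-filter-tabulate {n = suc n} P? g with does (P? (g zero))
... | true  = cong suc (length-filter-tabulate P? (g ∘ suc))
... | false = length-filter-tabulate P? (g ∘ suc)

count-++ : ∀ a b {p} {P : Pred (Fin (a + b)) p} (P? : Decidable P) →
           count P? ≡ count (P? ∘ (_↑ˡ b)) + count (P? ∘ (a ↑ʳ_))
count-++ zero    b P? = refl
count-++ (suc a) b P? =
  trans (cong (indicator (P? zero) +_) (count-++ a b (P? ∘ suc)))
        (sym (+-assoc (indicator (P? zero)) (count (P? ∘ suc ∘ (_↑ˡ b)))
                      (count (P? ∘ suc ∘ (a ↑ʳ_)))))

count-tail : ∀ {n p} {P : Pred (Fin (suc n)) p} (P? : Decidable P) →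
             count (P? ∘ suc) ≤ count P?
count-tail P? = m≤n+m _ _

count-mono : ∀ {n p q} {P : Pred (Fin n) p} {Q : Pred (Fin n) q}
             (P? : Decidable P) (Q? : Decidable Q) →
             (∀ i → P i → Q i) → count P? ≤ count Q?
count-mono {zero}  P? Q? P⇒Q = z≤n
count-mono {suc n} P? Q? P⇒Q with P? zero | Q? zero
... | yes _ | yes _ = s≤s (count-mono (P? ∘ suc) (Q? ∘ suc) (P⇒Q ∘ suc))
... | yes p | no ¬q = contradiction (P⇒Q zero p) ¬q
... | no _  | yes _ = ≤-trans (count-mono (P? ∘ suc) (Q? ∘ suc) (P⇒Q ∘ suc)) (m≤n+m _ 1)
... | no _  | no _  = count-mono (P? ∘ suc) (Q? ∘ suc) (P⇒Q ∘ suc)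

count-all : ∀ {n p} {P : Pred (Fin n) p} (P? : Decidable P) → (∀ i → P i) → count P? ≡ n
count-all {zero}  P? all = refl
count-all {suc n} P? all with P? zero
... | yes _  = cong suc (count-all (P? ∘ suc) (all ∘ suc))
... | no ¬p = contradiction (all zero) ¬p

-- k mod 4, computed by peeling off blocks of four so that it reduces on 4 + k.
residue : ℕ → Fin 4
residue zero                      = zero
residue (suc zero)                = suc zero
residue (suc (suc zero))          = suc (suc zero)
residue (suc (suc (suc zero)))    = suc (suc (suc zero))
residue (suc (suc (suc (suc k)))) = residue k

residueCount : ℕ → Fin 4 → ℕ
residueCount m r = count (λ (j : Fin m) → residue (toℕ j) Fin.≟ r)

-- Each block of four consecutive numbers contains exactly one of each residue.
residue-block : ∀ (r : Fin 4) x →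
  indicator (zero Fin.≟ r) + (indicator (suc zero Fin.≟ r) +
  (indicator (suc (suc zero) Fin.≟ r) + (indicator (suc (suc (suc zero)) Fin.≟ r) + x)))
  ≡ suc x
residue-block zero                   x = refl
residue-block (suc zero)             x = refl
residue-block (suc (suc zero))       x = refl
residue-block (suc (suc (suc zero))) x = refl

residueCount-bound : ∀ m r → m ≤ residueCount m r * 4 + 3
residueCount-bound zero                      r = z≤n
residueCount-bound (suc zero)                r = ≤-trans (s≤s z≤n) (m≤n+m 3 _)
residueCount-bound (suc (suc zero))          r = ≤-trans (s≤s (s≤s z≤n)) (m≤n+m 3 _)
residueCount-bound (suc (suc (suc zero)))    r = m≤n+m 3 _
residueCount-bound (suc (suc (suc (suc m)))) r =
  subst (λ k → 4 + m ≤ k * 4 + 3) (sym (residue-block r (residueCount m r)))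
        (s≤s (s≤s (s≤s (s≤s (residueCount-bound m r)))))

-- If m₁ ≤ 4C + 3, m₁ ≤ m₂ and 16 ≤ m₁ + m₂, then m₁ + 4 ≤ 2C + m₂.
-- For C ≥ 2 this follows from m₁ ≤ m₂; for C ≤ 1 the star sizes are
-- unbalanced enough (m₂ ≥ 13, resp. m₂ ≥ 9).
slack : ∀ {m₁ m₂} C → m₁ ≤ C * 4 + 3 → m₁ ≤ m₂ → 16 ≤ m₁ + m₂ →
        4 + m₁ ≤ (C + C) + m₂
slack {m₁} {m₂} zero m₁≤3 _ 16≤m₁+m₂ =
  ≤-trans (+-monoʳ-≤ 4 m₁≤3) (≤-trans (m≤m+n 7 6) 13≤m₂)
  where
  13≤m₂ : 13 ≤ m₂
  13≤m₂ = +-cancelˡ-≤ 3 13 m₂ (≤-trans 16≤m₁+m₂ (+-monoˡ-≤ m₂ m₁≤3))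
slack {m₁} {m₂} (suc zero) m₁≤7 _ 16≤m₁+m₂ =
  ≤-trans (+-monoʳ-≤ 4 m₁≤7) (+-monoʳ-≤ 2 9≤m₂)
  where
  9≤m₂ : 9 ≤ m₂
  9≤m₂ = +-cancelˡ-≤ 7 9 m₂ (≤-trans 16≤m₁+m₂ (+-monoˡ-≤ m₂ m₁≤7))
slack (suc (suc D)) _ m₁≤m₂ _ = +-mono-≤ (+-mono-≤ 2≤C 2≤C) m₁≤m₂
  where
  2≤C : 2 ≤ suc (suc D)
  2≤C = s≤s (s≤s z≤n)

exceeds-half : ∀ {m₁ m₂} C → m₁ ≤ C * 4 + 3 → m₁ ≤ m₂ → 16 ≤ m₁ + m₂ →
               ceilDiv (suc m₁ + suc m₂) 2 < C + m₂
exceeds-half {m₁} {m₂} C m₁≤4C+3 m₁≤m₂ 16≤m₁+m₂ = m<n*o⇒m/o<n (begin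
    suc (m₁ + suc m₂ + 2)  ≡⟨ regroupˡ m₁ m₂ ⟩
    (4 + m₁) + m₂          ≤⟨ +-monoˡ-≤ m₂ (slack C m₁≤4C+3 m₁≤m₂ 16≤m₁+m₂) ⟩
    (C + C) + m₂ + m₂      ≡⟨ regroupʳ C m₂ ⟩
    (C + m₂) * 2           ∎)
  where
  open ≤-Reasoning
  regroupˡ : ∀ x y → suc (x + suc y + 2) ≡ (4 + x) + y
  regroupˡ = solve-∀
  regroupʳ : ∀ x y → (x + x) + y + y ≡ (x + y) * 2
  regroupʳ = solve-∀

union-adjˡ : ∀ {a b} (G : Graph a) (H : Graph b) {u v : Fin a} →
             Adj G u v → Adj (DisjointUnion G H) (u ↑ˡ b) (v ↑ˡ b)
union-adjˡ {a} {b} G H {u} {v} =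
  subst₂ (SumAdj G H) (sym (Fin.splitAt-↑ˡ a u b)) (sym (Fin.splitAt-↑ˡ a v b))

union-adjʳ : ∀ {a b} (G : Graph a) (H : Graph b) {u v : Fin b} →
             Adj H u v → Adj (DisjointUnion G H) (a ↑ʳ u) (a ↑ʳ v)
union-adjʳ {a} {b} G H {u} {v} =
  subst₂ (SumAdj G H) (sym (Fin.splitAt-↑ʳ a b u)) (sym (Fin.splitAt-↑ʳ a b v))

∈-pair : ∀ {z x y : ℕ} → z ∈ x ∷ y ∷ [] → z ≡ x ⊎ z ≡ y
∈-pair (here z≡x)         = inj₁ z≡x
∈-pair (there (here z≡y)) = inj₂ z≡y

forced : ∀ {n} {G : Graph n} {L : ListAssignment n} {f : Fin n → Color} →
         IsProperLColoring G L f → ∀ {u v x y} →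
         Adj G u v → f u ≡ x → L v ⊆ x ∷ y ∷ [] → f v ≡ y
forced (inL , proper) {u} {v} uv fu≡x Lv⊆xy with ∈-pair (Lv⊆xy (inL v))
... | inj₁ fv≡x = ⊥-elim (proper u v uv (trans fu≡x (sym fv≡x)))
... | inj₂ fv≡y = fv≡y

leafList : Fin 4 → List Color
leafList zero                   = 1 ∷ 3 ∷ []
leafList (suc zero)             = 1 ∷ 4 ∷ []
leafList (suc (suc zero))       = 2 ∷ 3 ∷ []
leafList (suc (suc (suc zero))) = 2 ∷ 4 ∷ []

badList : ∀ {m₁ m₂} → Fin (suc m₁) ⊎ Fin (suc m₂) → List Color
badList (inj₁ zero)    = 1 ∷ 2 ∷ []
badList (inj₁ (suc j)) = leafList (residue (toℕ j))
badList (inj₂ _)       = 3 ∷ 4 ∷ []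

badAssignment : ∀ m₁ m₂ → ListAssignment (suc m₁ + suc m₂)
badAssignment m₁ m₂ v = badList {m₁} {m₂} (splitAt (suc m₁) v)

two-distinct : ∀ {x y : ℕ} → x ≢ y → Unique (x ∷ y ∷ []) × length (x ∷ y ∷ []) ≡ 2
two-distinct x≢y = ((x≢y ∷ []) ∷ [] ∷ []) , refl

badAssignment-is-2 : ∀ m₁ m₂ → IsKAssignment 2 (badAssignment m₁ m₂)
badAssignment-is-2 m₁ m₂ v with splitAt (suc m₁) v
... | inj₁ zero    = two-distinct (λ ())
... | inj₂ _       = two-distinct (λ ())
... | inj₁ (suc j) with residue (toℕ j)
...   | zero                   = two-distinct (λ ())
...   | suc zero               = two-distinct (λ ())
...   | suc (suc zero)         = two-distinct (λ ())
...   | suc (suc (suc zero))   = two-distinct (λ ())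

HeavyColour : ∀ m₁ m₂ → (Fin (suc m₁ + suc m₂) → Color) → Set
HeavyColour m₁ m₂ f = ∃₂ λ c C →
  InPalette (badAssignment m₁ m₂) c × m₁ ≤ C * 4 + 3 × C + m₂ ≤ colorCount f c

module _ (m₁ m₂ : ℕ) (f : Fin (suc m₁ + suc m₂) → Color)
         (proper : IsProperLColoring (TwoStars m₁ m₂) (badAssignment m₁ m₂) f) where

  private
    L : ListAssignment (suc m₁ + suc m₂)
    L = badAssignment m₁ m₂

    centre₁ centre₂ : Fin (suc m₁ + suc m₂)
    centre₁ = zero
    centre₂ = suc m₁ ↑ʳ zero

    leaf₁ : Fin m₁ → Fin (suc m₁ + suc m₂)
    leaf₁ j = suc j ↑ˡ suc m₂

    leaf₂ : Fin m₂ → Fin (suc m₁ + suc m₂)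
    leaf₂ j = suc m₁ ↑ʳ suc j

    list-centre₂ : L centre₂ ≡ 3 ∷ 4 ∷ []
    list-centre₂ = cong badList (Fin.splitAt-↑ʳ (suc m₁) (suc m₂) zero)

    list-leaf₁ : ∀ j → L (leaf₁ j) ≡ leafList (residue (toℕ j))
    list-leaf₁ j = cong badList (Fin.splitAt-↑ˡ (suc m₁) (suc j) (suc m₂))

    list-leaf₂ : ∀ j → L (leaf₂ j) ≡ 3 ∷ 4 ∷ []
    list-leaf₂ j = cong badList (Fin.splitAt-↑ʳ (suc m₁) (suc m₂) (suc j))

    colour-centre₁ : f centre₁ ≡ 1 ⊎ f centre₁ ≡ 2
    colour-centre₁ = ∈-pair (proj₁ proper centre₁)

    colour-centre₂ : f centre₂ ≡ 3 ⊎ f centre₂ ≡ 4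
    colour-centre₂ = ∈-pair (subst (f centre₂ ∈_) list-centre₂ (proj₁ proper centre₂))

    second-star-forced : ∀ {b c} → f centre₂ ≡ b → 3 ∷ 4 ∷ [] ⊆ b ∷ c ∷ [] →
                         ∀ j → f (leaf₂ j) ≡ c
    second-star-forced fb sub j =
      forced proper (union-adjʳ (Star m₁) (Star m₂) {zero} {suc j} tt) fb
             (⊆-trans (⊆-reflexive (list-leaf₂ j)) sub)

    first-star-forced : ∀ {a c} r → f centre₁ ≡ a → leafList r ⊆ a ∷ c ∷ [] →
                        ∀ j → residue (toℕ j) ≡ r → f (leaf₁ j) ≡ c
    first-star-forced r fa sub j refl =
      forced proper (union-adjˡ (Star m₁) (Star m₂) {zero} {suc j} tt) fa
             (⊆-trans (⊆-reflexive (list-leaf₁ j)) sub)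

    colour-class : ∀ c r → (∀ j → f (leaf₂ j) ≡ c) →
                   (∀ j → residue (toℕ j) ≡ r → f (leaf₁ j) ≡ c) →
                   residueCount m₁ r + m₂ ≤ colorCount f c
    colour-class c r on-leaf₂ on-leaf₁ = begin
      residueCount m₁ r + m₂
        ≡⟨ cong (residueCount m₁ r +_) (sym (count-all (λ j → f (leaf₂ j) ≟ c) on-leaf₂)) ⟩
      residueCount m₁ r + count (λ j → f (leaf₂ j) ≟ c)
        ≤⟨ +-monoˡ-≤ _ (count-mono _ (λ j → f (leaf₁ j) ≟ c) on-leaf₁) ⟩
      count (λ j → f (leaf₁ j) ≟ c) + count (λ j → f (leaf₂ j) ≟ c)
        ≤⟨ +-mono-≤ (count-tail {m₁} (λ (i : Fin (suc m₁)) → f (i ↑ˡ suc m₂) ≟ c))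
                    (count-tail {m₂} (λ i → f (suc m₁ ↑ʳ i) ≟ c)) ⟩
      count (λ (i : Fin (suc m₁)) → f (i ↑ˡ suc m₂) ≟ c) + count (λ i → f (suc m₁ ↑ʳ i) ≟ c)
        ≡⟨ sym (count-++ (suc m₁) (suc m₂) (λ v → f v ≟ c)) ⟩
      count (λ v → f v ≟ c)
        ≡⟨ sym (length-filter-tabulate (λ v → f v ≟ c) (λ v → v)) ⟩
      colorCount f c ∎
      where open ≤-Reasoning

    -- {3,4} in the order used when the second centre gets 4.
    swap : 3 ∷ 4 ∷ [] ⊆ 4 ∷ 3 ∷ []
    swap = ⊆-reflexive-↭ (↭-swap 3 4 ↭-refl)

    heavy : ∀ {a b} c r → f centre₁ ≡ a → f centre₂ ≡ b → c ∈ 3 ∷ 4 ∷ [] →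
            3 ∷ 4 ∷ [] ⊆ b ∷ c ∷ [] → leafList r ⊆ a ∷ c ∷ [] →
            HeavyColour m₁ m₂ f
    heavy c r fa fb c∈34 sub₂ sub₁ =
      c , residueCount m₁ r ,
      (centre₂ , subst (c ∈_) (sym list-centre₂) c∈34) ,
      residueCount-bound m₁ r ,
      colour-class c r (second-star-forced fb sub₂) (first-star-forced r fa sub₁)

  -- Split on the colours of the two centres; each case picks c and the residue r
  -- with leafList r = {a, c}.
  heavy-colour : HeavyColour m₁ m₂ f
  heavy-colour with colour-centre₁ | colour-centre₂
  ... | inj₁ f₁≡1 | inj₁ f₂≡3 = heavy 4 (suc zero) f₁≡1 f₂≡3 (there (here refl)) ⊆-refl ⊆-refl
  ... | inj₁ f₁≡1 | inj₂ f₂≡4 = heavy 3 zero f₁≡1 f₂≡4 (here refl) swap ⊆-refl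
  ... | inj₂ f₁≡2 | inj₁ f₂≡3 = heavy 4 (suc (suc (suc zero))) f₁≡2 f₂≡3 (there (here refl)) ⊆-refl ⊆-refl
  ... | inj₂ f₁≡2 | inj₂ f₂≡4 = heavy 3 (suc (suc zero)) f₁≡2 f₂≡4 (here refl) swap ⊆-refl

lemma3p4 : (m₁ m₂ : ℕ) → 1 ≤ m₁ → m₁ ≤ m₂ → 16 ≤ m₁ + m₂ →
           ¬ EquitablyChoosable (TwoStars m₁ m₂) 2
lemma3p4 m₁ m₂ _ m₁≤m₂ 16≤m₁+m₂ choosable
  with choosable (badAssignment m₁ m₂) (badAssignment-is-2 m₁ m₂)
... | f , proper , equitable
  with heavy-colour m₁ m₂ f proper
... | c , C , c∈palette , m₁≤4C+3 , C+m₂≤count =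
  <⇒≱ (<-≤-trans (exceeds-half C m₁≤4C+3 m₁≤m₂ 16≤m₁+m₂) C+m₂≤count)
      (equitable c c∈palette)
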